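{- Let $P$ be an $n\times n$ ($n\ge1$) permutation matrix with trace $0$ which is settled and Strang canonical, and let $w$ be its bandwidth. Then $P$ can be written as a product of fewer than $2w$ permutation matrices each of bandwidth at most $1$.
   Context: For an $n\times n$ permutation matrix $Q$, let $c_i(Q)$ be the column index of the $1$ in row $i$. The bandwidth of $Q$ is $\max_i|c_i(Q)-i|$; a matrix $M=(m_{ij})$ has bandwidth at most $1$ if $m_{ij}=0$ whenever $|i-j|>1$. Rows $i<j$ form an inverted pair if $c_i(Q)>c_j(Q)$, otherwise a contented pair. Row $i$ is positive if $c_i(Q)>i$, negative if $c_i(Q)<i$, neutral if $c_i(Q)=i$. Column $j$ is positive (negative, neutral) if the $1$ in column $j$ lies above (below, on) the diagonal. Sections: take the finest partition of $\{1,\dots,n\}$ into consecutive intervals each mapped onto itself by $i\mapsto c_i(Q)$; the corresponding diagonal blocks are the sections of $Q$. A section is upper-canonical if its positive rows are pairwise contented, lower-canonical if its negative rows are pairwise contented; $Q$ is Strang canonical if every section is both. A section is row-settled if all its positive rows lie above all its negative rows, and column-settled if all its negative columns lie to the left of all its positive columns. $Q$ is settled if either all its sections are row-settled or all its sections are column-settled. -}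

module Defs where

open import Data.Nat using (ℕ; zero; suc; _+_; _*_; _∸_; _≤_; _<_; _⊔_)
open import Data.Fin using (Fin; toℕ)
open import Data.Fin.Permutation using (Permutation′; _⟨$⟩ʳ_; _⟨$⟩ˡ_; id; _∘ₚ_; _≈_)
open import Data.List using (List; []; _∷_; foldr; map; length)
open import Data.List.Relation.Unary.All using (All)
open import Data.List using (allFin)
open import Data.Product using (_×_)
open import Data.Sum using (_⊎_)
open import Relation.Binary.PropositionalEquality using (_≡_; _≢_)

-- A permutation matrix Q is represented by its permutation i ↦ c_i(Q)
-- (row i has its 1 in column c_i(Q)); rows/columns are indexed 0..n-1.
PermMatrix : ℕ → Set
PermMatrix n = Permutation′ n

c : ∀ {n} → PermMatrix n → Fin n → ℕ
c Q i = toℕ (Q ⟨$⟩ʳ i)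

r : ∀ {n} → PermMatrix n → Fin n → ℕ
r Q j = toℕ (Q ⟨$⟩ˡ j)

dist : ℕ → ℕ → ℕ
dist a b = (a ∸ b) + (b ∸ a)

bandwidth : ∀ {n} → PermMatrix n → ℕ
bandwidth {n} Q = foldr _⊔_ 0 (map (λ i → dist (c Q i) (toℕ i)) (allFin n))

BandwidthAtMost1 : ∀ {n} → PermMatrix n → Set
BandwidthAtMost1 Q = ∀ i → dist (c Q i) (toℕ i) ≤ 1

TraceZero : ∀ {n} → PermMatrix n → Set
TraceZero Q = ∀ i → c Q i ≢ toℕ i

-- matrix product Q₁ Q₂ ⋯ Qₖ; for permutation matrices c_i(QR) = c_{c_i(Q)}(R),
-- which is exactly Q ∘ₚ R.
product : ∀ {n} → List (PermMatrix n) → PermMatrix n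
product = foldr _∘ₚ_ id

PositiveRow NegativeRow : ∀ {n} → PermMatrix n → Fin n → Set
PositiveRow Q i = toℕ i < c Q i
NegativeRow Q i = c Q i < toℕ i

PositiveCol NegativeCol : ∀ {n} → PermMatrix n → Fin n → Set
PositiveCol Q j = r Q j < toℕ j
NegativeCol Q j = toℕ j < r Q j

Contented : ∀ {n} → PermMatrix n → Fin n → Fin n → Set
Contented Q i j = c Q i < c Q j

-- The sections (finest partition of the index set into consecutive
-- intervals each mapped onto itself) are exactly the intervals between
-- consecutive cut points; hence two indices lie in the same section iff
-- no cut point separates them.
Cut : ∀ {n} → PermMatrix n → ℕ → Set
Cut Q k = ∀ i → toℕ i < k → c Q i < k

SameSection : ∀ {n} → PermMatrix n → Fin n → Fin n → Set
SameSection Q i j = ∀ k → Cut Q k → (k ≤ toℕ i → k ≤ toℕ j) × (k ≤ toℕ j → k ≤ toℕ i)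

AllUpperCanonical : ∀ {n} → PermMatrix n → Set
AllUpperCanonical Q = ∀ i j → SameSection Q i j → toℕ i < toℕ j →
  PositiveRow Q i → PositiveRow Q j → Contented Q i j

AllLowerCanonical : ∀ {n} → PermMatrix n → Set
AllLowerCanonical Q = ∀ i j → SameSection Q i j → toℕ i < toℕ j →
  NegativeRow Q i → NegativeRow Q j → Contented Q i j

StrangCanonical : ∀ {n} → PermMatrix n → Set
StrangCanonical Q = AllUpperCanonical Q × AllLowerCanonical Q

AllRowSettled : ∀ {n} → PermMatrix n → Set
AllRowSettled Q = ∀ i j → SameSection Q i j →
  PositiveRow Q i → NegativeRow Q j → toℕ i < toℕ j

AllColumnSettled : ∀ {n} → PermMatrix n → Set
AllColumnSettled Q = ∀ i j → SameSection Q i j →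
  NegativeCol Q i → PositiveCol Q j → toℕ i < toℕ j

Settled : ∀ {n} → PermMatrix n → Set
Settled Q = AllRowSettled Q ⊎ AllColumnSettled Q

module Submission where

-- Write f for i ↦ c_i(P). Trace zero and Strang canonicity make f 321-avoiding, so its adjacent
-- descents are pairwise disjoint: swapping all of them at once is a permutation of bandwidth 1, and
-- composing f with it lowers by one the depth of every nest of inversions (each strictly inside the
-- previous one). A nest of depth d around an innermost inversion (a, b) provides X rows left of b
-- with values above f b and Y rows right of a with values below f a, where X + Y = d + 1; counting
-- with 321-avoidance gives X ≤ b − f b ≤ w and Y ≤ f a − a ≤ w. So every nest has depth below 2w,
-- and 2w − 1 rounds sort P.

open import Defs
open import Data.Nat using (ℕ; zero; suc; pred; _+_; _*_; _∸_; _⊔_; _≤_; _<_; z≤n; s≤s; s≤s⁻¹; >-nonZero)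
open import Data.Nat.Properties
open import Data.Fin using (Fin; toℕ; fromℕ<)
open import Data.Fin.Properties using (toℕ<n; toℕ-fromℕ<; fromℕ<-toℕ; toℕ-injective; injective⇒≤; any?; all?)
open import Data.Fin.Permutation using (Permutation′; permutation; _⟨$⟩ʳ_; _⟨$⟩ˡ_; inverseˡ; inverseʳ; _≈_)
open import Data.List using (List; []; _∷_; length; foldr)
open import Data.List.Membership.Propositional using (_∈_)
open import Data.List.Membership.Propositional.Properties using (∈-map⁺; ∈-allFin)
open import Data.List.Relation.Unary.Any using (here; there)
open import Data.List.Relation.Unary.All using (All; []; _∷_)
open import Data.Product using (Σ; _×_; _,_; proj₁; proj₂)
open import Data.Sum using (_⊎_; inj₁; inj₂)
open import Data.Empty using (⊥; ⊥-elim)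
open import Function using (_∘_)
open import Relation.Nullary using (¬_; Dec; yes; no)
open import Relation.Nullary.Decidable using (_×-dec_; _→-dec_)
open import Relation.Binary.PropositionalEquality
open import Relation.Binary.Definitions using (tri<; tri≈; tri>)

InjectiveOn : ℕ → (ℕ → ℕ) → Set
InjectiveOn m F = ∀ z z' → z < m → z' < m → F z ≡ F z' → z ≡ z'

injectiveOn⇒≤ : ∀ m k (F : ℕ → ℕ) → (∀ z → z < m → F z < k) → InjectiveOn m F → m ≤ k
injectiveOn⇒≤ m k F F<k F-inj = injective⇒≤ {f = G} G-injective
  where
  G : Fin m → Fin k
  G z = fromℕ< (F<k (toℕ z) (toℕ<n z))

  G-injective : ∀ {x y} → G x ≡ G y → x ≡ y
  G-injective {x} {y} e = toℕ-injective (F-inj _ _ (toℕ<n x) (toℕ<n y)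
    (trans (sym (toℕ-fromℕ< _)) (trans (cong toℕ e) (toℕ-fromℕ< _))))

pairwiseDistinct⇒injectiveOn : ∀ m (F : ℕ → ℕ) → (∀ z z' → z < z' → z' < m → F z ≢ F z') → InjectiveOn m F
pairwiseDistinct⇒injectiveOn m F distinct z z' z<m z'<m e with <-cmp z z'
... | tri< z<z' _ _ = ⊥-elim (distinct z z' z<z' z'<m e)
... | tri≈ _ z≡z' _ = z≡z'
... | tri> _ _ z'<z = ⊥-elim (distinct z' z z'<z z<m (sym e))

concatOn : ℕ → (ℕ → ℕ) → (ℕ → ℕ) → ℕ → ℕ
concatOn a F G z with z <? a
... | yes _ = F z
... | no _ = G (z ∸ a)

concatOn-cases : ∀ a F G z →
  (z < a × concatOn a F G z ≡ F z) ⊎ (a ≤ z × concatOn a F G z ≡ G (z ∸ a))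
concatOn-cases a F G z with z <? a
... | yes z<a = inj₁ (z<a , refl)
... | no z≮a = inj₂ (≮⇒≥ z≮a , refl)

∸-<-shift : ∀ a b z → a ≤ z → z < a + b → z ∸ a < b
∸-<-shift a b z a≤z z<a+b = +-cancelˡ-< a (z ∸ a) b (subst (_< a + b) (sym (m+[n∸m]≡n a≤z)) z<a+b)

disjoint-injectiveOn⇒+≤ : ∀ a b k (F G : ℕ → ℕ) →
  (∀ z → z < a → F z < k) → (∀ z → z < b → G z < k) →
  InjectiveOn a F → InjectiveOn b G → (∀ z z' → z < a → z' < b → F z ≢ G z') → a + b ≤ k
disjoint-injectiveOn⇒+≤ a b k F G F<k G<k F-inj G-inj disjoint =
  injectiveOn⇒≤ (a + b) k (concatOn a F G) bounded injective
  where
  bounded : ∀ z → z < a + b → concatOn a F G z < k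
  bounded z z<a+b with concatOn-cases a F G z
  ... | inj₁ (z<a , e) = subst (_< k) (sym e) (F<k z z<a)
  ... | inj₂ (a≤z , e) = subst (_< k) (sym e) (G<k (z ∸ a) (∸-<-shift a b z a≤z z<a+b))

  injective : InjectiveOn (a + b) (concatOn a F G)
  injective z z' z< z'< e with concatOn-cases a F G z | concatOn-cases a F G z'
  ... | inj₁ (z<a , e₁) | inj₁ (z'<a , e₂) = F-inj z z' z<a z'<a (trans (sym e₁) (trans e e₂))
  ... | inj₁ (z<a , e₁) | inj₂ (a≤z' , e₂) =
    ⊥-elim (disjoint z (z' ∸ a) z<a (∸-<-shift a b z' a≤z' z'<) (trans (sym e₁) (trans e e₂)))
  ... | inj₂ (a≤z , e₁) | inj₁ (z'<a , e₂) =
    ⊥-elim (disjoint z' (z ∸ a) z'<a (∸-<-shift a b z a≤z z<) (trans (sym e₂) (trans (sym e) e₁)))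
  ... | inj₂ (a≤z , e₁) | inj₂ (a≤z' , e₂) = ∸-cancelʳ-≡ a≤z a≤z'
    (G-inj _ _ (∸-<-shift a b z a≤z z<) (∸-<-shift a b z' a≤z' z'<) (trans (sym e₁) (trans e e₂)))

record BijectionOn (n : ℕ) (f g : ℕ → ℕ) : Set where
  field
    f<n : ∀ i → i < n → f i < n
    g<n : ∀ i → i < n → g i < n
    g∘f : ∀ i → i < n → g (f i) ≡ i
    f∘g : ∀ i → i < n → f (g i) ≡ i

  f-injective : InjectiveOn n f
  f-injective i j i<n j<n e = trans (sym (g∘f i i<n)) (trans (cong g e) (g∘f j j<n))

  g-injective : InjectiveOn n g
  g-injective i j i<n j<n e = trans (sym (f∘g i i<n)) (trans (cong f e) (f∘g j j<n))

  f-≮⇒< : ∀ {i j} → i < n → j < n → i ≢ j → ¬ f j < f i → f i < f j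
  f-≮⇒< i<n j<n i≢j fj≮fi = ≤∧≢⇒< (≮⇒≥ fj≮fi) (i≢j ∘ f-injective _ _ i<n j<n)

Inversion : (ℕ → ℕ) → ℕ → ℕ → ℕ → Set
Inversion f n i j = i < j × j < n × f j < f i

Avoids321 : (ℕ → ℕ) → ℕ → Set
Avoids321 f n = ∀ p q r → p < q → q < r → r < n → f r < f q → f q < f p → ⊥

data NestedInversions (f : ℕ → ℕ) (n : ℕ) : ℕ → ℕ → ℕ → Set where
  single : ∀ {i j} → Inversion f n i j → NestedInversions f n 1 i j
  moveˡ  : ∀ {d i j k} → Inversion f n i j → i < k → k < j →
           NestedInversions f n d k j → NestedInversions f n (suc d) i j
  moveʳ  : ∀ {d i j k} → Inversion f n i j → i < k → k < j →
           NestedInversions f n d i k → NestedInversions f n (suc d) i j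

outerInversion : ∀ {f n d i j} → NestedInversions f n d i j → Inversion f n i j
outerInversion (single inv)       = inv
outerInversion (moveˡ inv _ _ _) = inv
outerInversion (moveʳ inv _ _ _) = inv

Descent : (ℕ → ℕ) → ℕ → ℕ → Set
Descent f n p = suc p < n × f (suc p) < f p

descent? : ∀ f n p → Dec (Descent f n p)
descent? f n p = (suc p <? n) ×-dec (f (suc p) <? f p)

DescentEndingAt : (ℕ → ℕ) → ℕ → ℕ → Set
DescentEndingAt f n zero    = ⊥
DescentEndingAt f n (suc p) = Descent f n p

descentEndingAt? : ∀ f n p → Dec (DescentEndingAt f n p)
descentEndingAt? f n zero    = no λ ()
descentEndingAt? f n (suc p) = descent? f n p

swapDescents : (ℕ → ℕ) → ℕ → ℕ → ℕ
swapDescents f n p with descent? f n p | descentEndingAt? f n p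
... | yes _ | _     = suc p
... | no _  | yes _ = pred p
... | no _  | no _  = p

swapDescents-cases : ∀ f n p →
  (Descent f n p × swapDescents f n p ≡ suc p) ⊎
  (¬ Descent f n p × DescentEndingAt f n p × swapDescents f n p ≡ pred p) ⊎
  (¬ Descent f n p × ¬ DescentEndingAt f n p × swapDescents f n p ≡ p)
swapDescents-cases f n p with descent? f n p | descentEndingAt? f n p
... | yes d  | _      = inj₁ (d , refl)
... | no ¬d  | yes d' = inj₂ (inj₁ (¬d , d' , refl))
... | no ¬d  | no ¬d' = inj₂ (inj₂ (¬d , ¬d' , refl))

dist≤1 : ∀ a p → a ≤ suc p → pred p ≤ a → dist a p ≤ 1
dist≤1 zero          zero          _ _ = z≤n
dist≤1 zero          (suc zero)    _ _ = s≤s z≤n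
dist≤1 (suc zero)    zero          _ _ = s≤s z≤n
dist≤1 (suc (suc a)) zero          (s≤s ()) _
dist≤1 zero          (suc (suc p)) _ ()
dist≤1 (suc a)       (suc p)       a≤p pred≤a = dist≤1 a p (s≤s⁻¹ a≤p) (pred-mono-≤ pred≤a)

involutionPermutation : ∀ n (h : ℕ → ℕ) → (∀ p → p < n → h p < n) → (∀ p → p < n → h (h p) ≡ p) →
  Permutation′ n
involutionPermutation n h h<n involutive = permutation H H H∘H H∘H
  where
  H : Fin n → Fin n
  H i = fromℕ< (h<n (toℕ i) (toℕ<n i))

  H∘H : ∀ i → H (H i) ≡ i
  H∘H i = toℕ-injective (trans (toℕ-fromℕ< _)
    (trans (cong h (toℕ-fromℕ< _)) (involutive (toℕ i) (toℕ<n i))))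

involutionPermutation-apply : ∀ n h h<n involutive (i : Fin n) →
  toℕ (involutionPermutation n h h<n involutive ⟨$⟩ʳ i) ≡ h (toℕ i)
involutionPermutation-apply n h h<n involutive i = toℕ-fromℕ< _

wideInversion⇒nested : ∀ {n f g} → BijectionOn n f g → ∀ {a b} →
  Inversion f n a b → suc a < b → NestedInversions f n 2 a b
wideInversion⇒nested {f = f} bij {a} {b} inv@(_ , b<n , fb<fa) a+1<b with <-cmp (f (suc a)) (f b)
... | tri< fa+1<fb _ _ = moveʳ inv (n<1+n a) a+1<b (single (n<1+n a , <-trans a+1<b b<n , <-trans fa+1<fb fb<fa))
... | tri≈ _ fa+1≡fb _ = ⊥-elim (<⇒≢ a+1<b (BijectionOn.f-injective bij _ _ (<-trans a+1<b b<n) b<n fa+1≡fb))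
... | tri> _ _ fb<fa+1 = moveˡ inv (n<1+n a) a+1<b (single (a+1<b , b<n , fb<fa+1))

module SwapDescents {n : ℕ} {f : ℕ → ℕ} (avoids : Avoids321 f n) where

  σ : ℕ → ℕ
  σ = swapDescents f n

  σ<n : ∀ p → p < n → σ p < n
  σ<n p p<n with swapDescents-cases f n p
  ... | inj₁ ((p+1<n , _) , e)    = subst (_< n) (sym e) p+1<n
  ... | inj₂ (inj₁ (_ , _ , e)) = subst (_< n) (sym e) (≤-<-trans pred[n]≤n p<n)
  ... | inj₂ (inj₂ (_ , _ , e)) = subst (_< n) (sym e) p<n

  σ≤suc : ∀ p → σ p ≤ suc p
  σ≤suc p with swapDescents-cases f n p
  ... | inj₁ (_ , e)            = ≤-reflexive e
  ... | inj₂ (inj₁ (_ , _ , e)) = ≤-trans (≤-reflexive e) (≤-trans pred[n]≤n (n≤1+n p))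
  ... | inj₂ (inj₂ (_ , _ , e)) = ≤-trans (≤-reflexive e) (n≤1+n p)

  pred≤σ : ∀ p → pred p ≤ σ p
  pred≤σ p with swapDescents-cases f n p
  ... | inj₁ (_ , e)            = ≤-trans (≤-trans pred[n]≤n (n≤1+n p)) (≤-reflexive (sym e))
  ... | inj₂ (inj₁ (_ , _ , e)) = ≤-reflexive (sym e)
  ... | inj₂ (inj₂ (_ , _ , e)) = ≤-trans pred[n]≤n (≤-reflexive (sym e))

  σ-descent : ∀ {p} → Descent f n p → σ p ≡ suc p
  σ-descent {p} d with swapDescents-cases f n p
  ... | inj₁ (_ , e)             = e
  ... | inj₂ (inj₁ (¬d , _))     = ⊥-elim (¬d d)
  ... | inj₂ (inj₂ (¬d , _))     = ⊥-elim (¬d d)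

  σ≡suc⇒descent : ∀ {p} → σ p ≡ suc p → Descent f n p
  σ≡suc⇒descent {p} σp≡p+1 with swapDescents-cases f n p
  ... | inj₁ (d , _)             = d
  ... | inj₂ (inj₁ (_ , _ , e)) = ⊥-elim (<-irrefl (trans (sym e) σp≡p+1) (s≤s pred[n]≤n))
  ... | inj₂ (inj₂ (_ , _ , e)) = ⊥-elim (<-irrefl (trans (sym e) σp≡p+1) ≤-refl)

  -- Two adjacent descents (p, p+1) and (p+1, p+2) would be a 321 pattern.
  σ-involutive : ∀ p → p < n → σ (σ p) ≡ p
  σ-involutive p p<n with swapDescents-cases f n p
  ... | inj₁ ((p+1<n , fp+1<fp) , e) rewrite e with swapDescents-cases f n (suc p)
  ...   | inj₁ ((p+2<n , fp+2<fp+1) , _) =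
    ⊥-elim (avoids p (suc p) (suc (suc p)) (n<1+n p) (n<1+n (suc p)) p+2<n fp+2<fp+1 fp+1<fp)
  ...   | inj₂ (inj₁ (_ , _ , e')) = e'
  ...   | inj₂ (inj₂ (_ , ¬d' , _)) = ⊥-elim (¬d' (p+1<n , fp+1<fp))
  σ-involutive (suc p) _ | inj₂ (inj₁ (_ , d' , e)) rewrite e = σ-descent d'
  σ-involutive p _ | inj₂ (inj₂ (_ , _ , e)) rewrite e = e

  σ-injective : InjectiveOn n σ
  σ-injective p q p<n q<n e = trans (sym (σ-involutive p p<n)) (trans (cong σ e) (σ-involutive q q<n))

  σ-bandwidth≤1 : BandwidthAtMost1 (involutionPermutation n σ σ<n σ-involutive)
  σ-bandwidth≤1 i rewrite involutionPermutation-apply n σ σ<n σ-involutive i =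
    dist≤1 (σ (toℕ i)) (toℕ i) (σ≤suc (toℕ i)) (pred≤σ (toℕ i))

  -- σ only moves points by one, so it can reverse p < q only when (p, q) = (p, p+1) is a descent.
  σ-reversal⇒descent : ∀ {p q} → p < q → σ q < σ p → f (σ p) < f (σ q)
  σ-reversal⇒descent {p} {suc q} (s≤s p≤q) σq<σp = subst₂ (λ u v → f u < f v) (sym σp≡p+1) (sym σq≡p) (proj₂ dp)
    where
    q≤σq : q ≤ σ (suc q)
    q≤σq = pred≤σ (suc q)
    q≡p : q ≡ p
    q≡p = ≤-antisym (s≤s⁻¹ (≤-trans (s≤s q≤σq) (≤-trans σq<σp (σ≤suc p)))) p≤q
    p≤σq : p ≤ σ (suc q)
    p≤σq = subst (_≤ σ (suc q)) q≡p q≤σq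
    σp≡p+1 : σ p ≡ suc p
    σp≡p+1 = ≤-antisym (σ≤suc p) (≤-trans (s≤s p≤σq) σq<σp)
    σq≡p : σ (suc q) ≡ p
    σq≡p = ≤-antisym (s≤s⁻¹ (subst (σ (suc q) <_) σp≡p+1 σq<σp)) p≤σq
    dp : Descent f n p
    dp = σ≡suc⇒descent σp≡p+1

  σ-≮⇒< : ∀ {p q} → p < q → q < n → ¬ σ q < σ p → σ p < σ q
  σ-≮⇒< p<q q<n σq≮σp = ≤∧≢⇒< (≮⇒≥ σq≮σp) (<⇒≢ p<q ∘ σ-injective _ _ (<-trans p<q q<n) q<n)

  module Composed {g : ℕ → ℕ} (bij : BijectionOn n f g) where
    open BijectionOn bij

    f∘σ : ℕ → ℕ
    f∘σ p = f (σ p)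

    bijection : BijectionOn n f∘σ (σ ∘ g)
    bijection = record
      { f<n = λ i i<n → f<n (σ i) (σ<n i i<n)
      ; g<n = λ i i<n → σ<n (g i) (g<n i i<n)
      ; g∘f = λ i i<n → trans (cong σ (g∘f (σ i) (σ<n i i<n))) (σ-involutive i i<n)
      ; f∘g = λ i i<n → trans (cong f (σ-involutive (g i) (g<n i i<n))) (f∘g i i<n)
      }

    σ-inversion : ∀ {i j} → Inversion f∘σ n i j → Inversion f n (σ i) (σ j)
    σ-inversion (i<j , j<n , fσj<fσi) =
      σ-≮⇒< i<j j<n (λ σj<σi → <-asym fσj<fσi (σ-reversal⇒descent i<j σj<σi)) , σ<n _ j<n , fσj<fσi

    avoids321 : Avoids321 f∘σ n
    avoids321 p q r p<q q<r r<n fσr<fσq fσq<fσp =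
      avoids (σ p) (σ q) (σ r)
        (proj₁ (σ-inversion (p<q , <-trans q<r r<n , fσq<fσp)))
        (proj₁ (σ-inversion (q<r , r<n , fσr<fσq)))
        (σ<n r r<n) fσr<fσq fσq<fσp

    -- If σ j = σ i + 1 then (σ i, σ j) is a descent of f, so σ swaps it back and i = j + 1.
    σ-inversion-wide : ∀ {i j} → Inversion f∘σ n i j → suc (σ i) < σ j
    σ-inversion-wide {i} {j} inv@(i<j , j<n , fσj<fσi) with m≤n⇒m<n∨m≡n (proj₁ (σ-inversion inv))
    ... | inj₁ wide = wide
    ... | inj₂ σi+1≡σj = ⊥-elim (<-asym i<j (subst (j <_) (sym i≡j+1) (n<1+n j)))
      where
      i≡σj : i ≡ σ j
      i≡σj = trans (sym (σ-involutive i (<-trans i<j j<n)))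
        (trans (σ-descent (subst (_< n) (sym σi+1≡σj) (σ<n j j<n) ,
                            subst (λ u → f u < f (σ i)) (sym σi+1≡σj) fσj<fσi)) σi+1≡σj)
      i≡j+1 : i ≡ suc j
      i≡j+1 = trans i≡σj (trans (sym σi+1≡σj) (cong suc (trans (cong σ i≡σj) (σ-involutive j j<n))))

    nested-lift : ∀ {d i j} → NestedInversions f∘σ n d i j → NestedInversions f n (suc d) (σ i) (σ j)
    nested-lift (single inv) = wideInversion⇒nested bij (σ-inversion inv) (σ-inversion-wide inv)
    nested-lift {i = i} {j} (moveˡ {k = k} inv i<k k<j chain) =
      moveˡ inv' (σ-≮⇒< i<k (<-trans k<j j<n) σk≮σi) (proj₁ (σ-inversion (outerInversion chain))) (nested-lift chain)
      where
      inv' = σ-inversion inv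
      j<n = proj₁ (proj₂ inv)
      σk≮σi : ¬ σ k < σ i
      σk≮σi σk<σi = avoids (σ k) (σ i) (σ j) σk<σi (proj₁ inv') (σ<n j j<n)
        (proj₂ (proj₂ inv)) (σ-reversal⇒descent i<k σk<σi)
    nested-lift {i = i} {j} (moveʳ {k = k} inv i<k k<j chain) =
      moveʳ inv' (proj₁ (σ-inversion (outerInversion chain))) (σ-≮⇒< k<j j<n σj≮σk) (nested-lift chain)
      where
      inv' = σ-inversion inv
      j<n = proj₁ (proj₂ inv)
      σj≮σk : ¬ σ j < σ k
      σj≮σk σj<σk = avoids (σ i) (σ j) (σ k) (proj₁ inv') σj<σk (σ<n k (<-trans k<j j<n))
        (σ-reversal⇒descent k<j σj<σk) (proj₂ (proj₂ inv))

strictMonoOn⇒≥ : ∀ n (h : ℕ → ℕ) → (∀ i j → i < j → j < n → h i < h j) → ∀ i → i < n → i ≤ h i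
strictMonoOn⇒≥ n h mono zero    _     = z≤n
strictMonoOn⇒≥ n h mono (suc i) i+1<n =
  ≤-<-trans (strictMonoOn⇒≥ n h mono i (<-trans (n<1+n i) i+1<n)) (mono i (suc i) (n<1+n i) i+1<n)

inversionFree⇒identity : ∀ {n f g} → BijectionOn n f g → (∀ i j → ¬ Inversion f n i j) →
  ∀ i → i < n → f i ≡ i
inversionFree⇒identity {n} {f} {g} bij noInversion i i<n =
  ≤-antisym (subst (f i ≤_) (g∘f i i<n) (strictMonoOn⇒≥ n g g-mono (f i) (f<n i i<n)))
            (strictMonoOn⇒≥ n f f-mono i i<n)
  where
  open BijectionOn bij

  f-mono : ∀ i j → i < j → j < n → f i < f j
  f-mono i j i<j j<n = f-≮⇒< (<-trans i<j j<n) j<n (<⇒≢ i<j) (λ fj<fi → noInversion i j (i<j , j<n , fj<fi))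

  g-mono : ∀ u v → u < v → v < n → g u < g v
  g-mono u v u<v v<n = ≤∧≢⇒< (≮⇒≥ gv≮gu) (<⇒≢ u<v ∘ g-injective u v u<n v<n)
    where
    u<n = <-trans u<v v<n
    gv≮gu : ¬ g v < g u
    gv≮gu gv<gu = <-asym u<v (subst₂ _<_ (f∘g v v<n) (f∘g u u<n) (f-mono _ _ gv<gu (g<n u u<n)))

sortInRounds : ∀ {n} t (f g : ℕ → ℕ) → BijectionOn n f g → Avoids321 f n →
  (∀ {d i j} → NestedInversions f n d i j → d ≤ t) →
  Σ (List (Permutation′ n)) λ Qs →
    length Qs ≤ t × All BandwidthAtMost1 Qs × (∀ i → toℕ (product Qs ⟨$⟩ʳ i) ≡ f (toℕ i))
sortInRounds zero f g bij _ depth≤0 =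
  [] , z≤n , [] , λ i → sym (inversionFree⇒identity bij (λ _ _ inv → n≮0 (depth≤0 (single inv))) (toℕ i) (toℕ<n i))
sortInRounds {n} (suc t) f g bij avoids depth≤
  with sortInRounds t f∘σ (σ ∘ g) bijection avoids321 (λ chain → s≤s⁻¹ (depth≤ (nested-lift chain)))
  where
  open SwapDescents avoids
  open Composed bij
... | Qs , length≤ , bands , product≡ = S ∷ Qs , s≤s length≤ , σ-bandwidth≤1 ∷ bands , λ i → begin
    toℕ (product Qs ⟨$⟩ʳ (S ⟨$⟩ʳ i))  ≡⟨ product≡ (S ⟨$⟩ʳ i) ⟩
    f (σ (toℕ (S ⟨$⟩ʳ i)))            ≡⟨ cong (f ∘ σ) (involutionPermutation-apply n σ σ<n σ-involutive i) ⟩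
    f (σ (σ (toℕ i)))                  ≡⟨ cong f (σ-involutive (toℕ i) (toℕ<n i)) ⟩
    f (toℕ i)                          ∎
  where
  open SwapDescents avoids
  open ≡-Reasoning
  S = involutionPermutation n σ σ<n σ-involutive

-- (a, b) is the innermost inversion of the nest; us and vs collect the left and right endpoints
-- of the enclosing inversions met on the way in.
record NestWitness (f : ℕ → ℕ) (n d i j : ℕ) : Set where
  field
    a b X Y       : ℕ
    us vs         : ℕ → ℕ
    depth         : suc d ≡ X + Y
    core          : Inversion f n a b
    i≤a           : i ≤ a
    b≤j           : b ≤ j
    fi≤fa         : f i ≤ f a
    fb≤fj         : f b ≤ f j
    us<b          : ∀ z → z < X → us z < b
    fb<f-us       : ∀ z → z < X → f b < f (us z)
    i≤us          : ∀ z → z < X → i ≤ us z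
    us-increasing : ∀ z z' → z < z' → z' < X → us z < us z'
    a<vs          : ∀ z → z < Y → a < vs z
    vs<n          : ∀ z → z < Y → vs z < n
    f-vs<fa       : ∀ z → z < Y → f (vs z) < f a
    vs≤j          : ∀ z → z < Y → vs z ≤ j
    vs-decreasing : ∀ z z' → z < z' → z' < Y → vs z' < vs z

_◂_ : ℕ → (ℕ → ℕ) → ℕ → ℕ
(x ◂ h) zero    = x
(x ◂ h) (suc z) = h z

module NestBound {n f g} (bij : BijectionOn n f g) (avoids : Avoids321 f n) where
  open BijectionOn bij

  inversion-between-aboveʳ : ∀ {i j k} → Inversion f n i j → i < k → k < j → f j < f k → f i < f k
  inversion-between-aboveʳ {i} {j} {k} (_ , j<n , fj<fi) i<k k<j fj<fk =
    f-≮⇒< (<-trans i<k k<n) k<n (<⇒≢ i<k) (λ fk<fi → avoids i k j i<k k<j j<n fj<fk fk<fi)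
    where k<n = <-trans k<j j<n

  inversion-between-belowˡ : ∀ {i j k} → Inversion f n i j → i < k → k < j → f k < f i → f k < f j
  inversion-between-belowˡ {i} {j} {k} (_ , j<n , fj<fi) i<k k<j fk<fi =
    f-≮⇒< (<-trans k<j j<n) j<n (<⇒≢ k<j) (λ fj<fk → avoids i k j i<k k<j j<n fj<fk fk<fi)

  nestWitness : ∀ {d i j} → NestedInversions f n d i j → NestWitness f n d i j
  nestWitness {i = i} {j} (single inv@(i<j , j<n , fj<fi)) = record
    { a = i ; b = j ; X = 1 ; Y = 1 ; us = λ _ → i ; vs = λ _ → j ; depth = refl
    ; core = inv ; i≤a = ≤-refl ; b≤j = ≤-refl ; fi≤fa = ≤-refl ; fb≤fj = ≤-refl
    ; us<b = λ _ _ → i<j ; fb<f-us = λ _ _ → fj<fi ; i≤us = λ _ _ → ≤-refl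
    ; us-increasing = λ _ _ z<z' z'<1 → ⊥-elim (n≮0 (<-≤-trans z<z' (s≤s⁻¹ z'<1)))
    ; a<vs = λ _ _ → i<j ; vs<n = λ _ _ → j<n ; f-vs<fa = λ _ _ → fj<fi ; vs≤j = λ _ _ → ≤-refl
    ; vs-decreasing = λ _ _ z<z' z'<1 → ⊥-elim (n≮0 (<-≤-trans z<z' (s≤s⁻¹ z'<1)))
    }
  nestWitness {i = i} {j} (moveˡ {k = k} inv@(_ , _ , fj<fi) i<k k<j chain) = record
    { a = a ; b = b ; X = suc X ; Y = Y ; us = i ◂ us ; vs = vs ; depth = cong suc depth
    ; core = core ; i≤a = <⇒≤ (<-≤-trans i<k i≤a) ; b≤j = b≤j
    ; fi≤fa = ≤-trans (<⇒≤ fi<fk) fi≤fa ; fb≤fj = fb≤fj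
    ; us<b = λ { zero _ → <-trans (<-≤-trans i<k i≤a) (proj₁ core) ; (suc z) z< → us<b z (s≤s⁻¹ z<) }
    ; fb<f-us = λ { zero _ → ≤-<-trans fb≤fj fj<fi ; (suc z) z< → fb<f-us z (s≤s⁻¹ z<) }
    ; i≤us = λ { zero _ → ≤-refl ; (suc z) z< → ≤-trans (<⇒≤ i<k) (i≤us z (s≤s⁻¹ z<)) }
    ; us-increasing = λ
        { _ zero () _
        ; zero (suc z') _ z'< → <-≤-trans i<k (i≤us z' (s≤s⁻¹ z'<))
        ; (suc z) (suc z') z<z' z'< → us-increasing z z' (s≤s⁻¹ z<z') (s≤s⁻¹ z'<) }
    ; a<vs = a<vs ; vs<n = vs<n ; f-vs<fa = f-vs<fa ; vs≤j = vs≤j ; vs-decreasing = vs-decreasing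
    }
    where
    open NestWitness (nestWitness chain)
    fi<fk : f i < f k
    fi<fk = inversion-between-aboveʳ inv i<k k<j (proj₂ (proj₂ (outerInversion chain)))
  nestWitness {i = i} {j} (moveʳ {k = k} inv@(_ , j<n , fj<fi) i<k k<j chain) = record
    { a = a ; b = b ; X = X ; Y = suc Y ; us = us ; vs = j ◂ vs
    ; depth = trans (cong suc depth) (sym (+-suc X Y))
    ; core = core ; i≤a = i≤a ; b≤j = ≤-trans b≤j (<⇒≤ k<j)
    ; fi≤fa = fi≤fa ; fb≤fj = ≤-trans fb≤fj (<⇒≤ fk<fj)
    ; us<b = us<b ; fb<f-us = fb<f-us ; i≤us = i≤us ; us-increasing = us-increasing
    ; a<vs = λ { zero _ → <-trans (<-≤-trans (proj₁ core) b≤j) k<j ; (suc z) z< → a<vs z (s≤s⁻¹ z<) }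
    ; vs<n = λ { zero _ → j<n ; (suc z) z< → vs<n z (s≤s⁻¹ z<) }
    ; f-vs<fa = λ { zero _ → <-≤-trans fj<fi fi≤fa ; (suc z) z< → f-vs<fa z (s≤s⁻¹ z<) }
    ; vs≤j = λ { zero _ → ≤-refl ; (suc z) z< → ≤-trans (vs≤j z (s≤s⁻¹ z<)) (<⇒≤ k<j) }
    ; vs-decreasing = λ
        { _ zero () _
        ; zero (suc z') _ z'< → ≤-<-trans (vs≤j z' (s≤s⁻¹ z'<)) k<j
        ; (suc z) (suc z') z<z' z'< → vs-decreasing z z' (s≤s⁻¹ z<z') (s≤s⁻¹ z'<) }
    }
    where
    open NestWitness (nestWitness chain)
    fk<fj : f k < f j
    fk<fj = inversion-between-belowˡ inv i<k k<j (proj₂ (proj₂ (outerInversion chain)))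

  -- The f b rows with values below f b all lie left of b (else a 321 with a, b), and so do the X rows us.
  witness-X≤b∸fb : ∀ {d i j} (w : NestWitness f n d i j) → NestWitness.X w ≤ NestWitness.b w ∸ f (NestWitness.b w)
  witness-X≤b∸fb w = m+n≤o⇒m≤o∸n X (subst (_≤ b) (+-comm (f b) X)
    (disjoint-injectiveOn⇒+≤ (f b) X b g us g<b us<b g-injectiveOn
      (pairwiseDistinct⇒injectiveOn X us (λ z z' z<z' z'< → <⇒≢ (us-increasing z z' z<z' z'<)))
      (λ z z' z<fb z'<X gz≡us → <-asym z<fb (subst (f b <_) (trans (cong f (sym gz≡us)) (f∘g z (z<n z<fb))) (fb<f-us z' z'<X)))))
    where
    open NestWitness w
    b<n = proj₁ (proj₂ core)
    z<n : ∀ {z} → z < f b → z < n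
    z<n z<fb = <-trans z<fb (f<n b b<n)
    g<b : ∀ z → z < f b → g z < b
    g<b z z<fb = ≤∧≢⇒< (≮⇒≥ b≮gz) (λ gz≡b → <⇒≢ z<fb (trans (sym (f∘g z (z<n z<fb))) (cong f gz≡b)))
      where
      b≮gz : ¬ b < g z
      b≮gz b<gz = avoids a b (g z) (proj₁ core) b<gz (g<n z (z<n z<fb))
        (subst (_< f b) (sym (f∘g z (z<n z<fb))) z<fb) (proj₂ (proj₂ core))
    g-injectiveOn : InjectiveOn (f b) g
    g-injectiveOn z z' z< z'< = g-injective z z' (z<n z<) (z<n z'<)

  -- Symmetrically, the a + 1 rows up to a and the Y rows vs all have values at most f a.
  witness-Y≤fa∸a : ∀ {d i j} (w : NestWitness f n d i j) → NestWitness.Y w ≤ f (NestWitness.a w) ∸ NestWitness.a w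
  witness-Y≤fa∸a w = m+n≤o⇒m≤o∸n Y (subst (_≤ f a) (+-comm a Y) (s≤s⁻¹
    (disjoint-injectiveOn⇒+≤ (suc a) Y (suc (f a)) f (f ∘ vs) f≤fa (λ z z< → s≤s (<⇒≤ (f-vs<fa z z<)))
      (λ z z' z< z'< → f-injective z z' (≤-<-trans (s≤s⁻¹ z<) a<n) (≤-<-trans (s≤s⁻¹ z'<) a<n))
      (pairwiseDistinct⇒injectiveOn Y (f ∘ vs) (λ z z' z<z' z'< e →
        >⇒≢ (vs-decreasing z z' z<z' z'<) (f-injective _ _ (vs<n z (<-trans z<z' z'<)) (vs<n z' z'<) e)))
      (λ z z' z< z'< fz≡fvs → <⇒≢ (≤-<-trans (s≤s⁻¹ z<) (a<vs z' z'<))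
        (f-injective _ _ (≤-<-trans (s≤s⁻¹ z<) a<n) (vs<n z' z'<) fz≡fvs)))))
    where
    open NestWitness w
    a<n = <-trans (proj₁ core) (proj₁ (proj₂ core))
    f≤fa : ∀ z → z < suc a → f z < suc (f a)
    f≤fa z z<a+1 with m≤n⇒m<n∨m≡n (s≤s⁻¹ z<a+1)
    ... | inj₂ z≡a = s≤s (≤-reflexive (cong f z≡a))
    ... | inj₁ z<a = s≤s (≮⇒≥ (λ fa<fz → avoids z a b z<a (proj₁ core) (proj₁ (proj₂ core)) (proj₂ (proj₂ core)) fa<fz))

  nested-depth<2w : ∀ w → (∀ p → p < n → dist (f p) p ≤ w) → ∀ {d i j} → NestedInversions f n d i j → suc d ≤ 2 * w
  nested-depth<2w w dist≤w {d} chain = begin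
    suc d               ≡⟨ depth ⟩
    X + Y               ≤⟨ +-mono-≤ (≤-trans (witness-X≤b∸fb wit) (≤-trans (m≤n+m (b ∸ f b) (f b ∸ b)) (dist≤w b b<n)))
                                   (≤-trans (witness-Y≤fa∸a wit) (≤-trans (m≤m+n (f a ∸ a) (a ∸ f a)) (dist≤w a a<n))) ⟩
    w + w               ≡⟨ cong (w +_) (sym (+-identityʳ w)) ⟩
    2 * w               ∎
    where
    open ≤-Reasoning
    wit = nestWitness chain
    open NestWitness wit
    b<n = proj₁ (proj₂ core)
    a<n = <-trans (proj₁ core) b<n

∈⇒≤foldr-⊔ : ∀ {x xs} → x ∈ xs → x ≤ foldr _⊔_ 0 xs
∈⇒≤foldr-⊔ {x} (here refl) = m≤m⊔n x _
∈⇒≤foldr-⊔ {xs = y ∷ _} (there x∈ys) = ≤-trans (∈⇒≤foldr-⊔ x∈ys) (m≤n⊔m y _)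

module _ {n : ℕ} (P : PermMatrix n) where

  -- c P and r P as functions on ℕ, extended by the identity beyond n.
  col row : ℕ → ℕ
  col k with k <? n
  ... | yes k<n = c P (fromℕ< k<n)
  ... | no _    = k
  row k with k <? n
  ... | yes k<n = r P (fromℕ< k<n)
  ... | no _    = k

  col-toℕ : ∀ i → col (toℕ i) ≡ c P i
  col-toℕ i with toℕ i <? n
  ... | yes i<n = cong (c P) (fromℕ<-toℕ i i<n)
  ... | no i≮n  = ⊥-elim (i≮n (toℕ<n i))

  row-toℕ : ∀ i → row (toℕ i) ≡ r P i
  row-toℕ i with toℕ i <? n
  ... | yes i<n = cong (r P) (fromℕ<-toℕ i i<n)
  ... | no i≮n  = ⊥-elim (i≮n (toℕ<n i))

  ∀<n : (Φ : ℕ → Set) → (∀ i → Φ (toℕ i)) → ∀ k → k < n → Φ k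
  ∀<n Φ φ k k<n = subst Φ (toℕ-fromℕ< k<n) (φ (fromℕ< k<n))

  col-bijection : BijectionOn n col row
  col-bijection = record
    { f<n = ∀<n (λ k → col k < n) (λ i → subst (_< n) (sym (col-toℕ i)) (toℕ<n _))
    ; g<n = ∀<n (λ k → row k < n) (λ i → subst (_< n) (sym (row-toℕ i)) (toℕ<n _))
    ; g∘f = ∀<n (λ k → row (col k) ≡ k) λ i →
        trans (cong row (col-toℕ i)) (trans (row-toℕ (P ⟨$⟩ʳ i)) (cong toℕ (inverseˡ P)))
    ; f∘g = ∀<n (λ k → col (row k) ≡ k) λ i →
        trans (cong col (row-toℕ i)) (trans (col-toℕ (P ⟨$⟩ˡ i)) (cong toℕ (inverseʳ P)))
    }

  dist≤bandwidth : ∀ i → dist (c P i) (toℕ i) ≤ bandwidth P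
  dist≤bandwidth i = ∈⇒≤foldr-⊔ (∈-map⁺ (λ j → dist (c P j) (toℕ j)) (∈-allFin i))

  col-dist≤bandwidth : ∀ k → k < n → dist (col k) k ≤ bandwidth P
  col-dist≤bandwidth = ∀<n (λ k → dist (col k) k ≤ bandwidth P)
    (λ i → subst (λ z → dist z (toℕ i) ≤ bandwidth P) (sym (col-toℕ i)) (dist≤bandwidth i))

  cut? : ∀ K → Dec (Cut P K)
  cut? K = all? (λ i → (toℕ i <? K) →-dec (c P i <? K))

  -- The K rows above a cut already fill the columns left of it.
  cut-closed : ∀ {K k} → Cut P K → K ≤ k → k < n → K ≤ col k
  cut-closed {K} {k} cut K≤k k<n = ≮⇒≥ λ colk<K → 1+n≰n (subst (_≤ K) (+-comm K 1)
    (disjoint-injectiveOn⇒+≤ K 1 K col (λ _ → col k) col<K (λ _ _ → colk<K)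
      (λ z z' z<K z'<K → f-injective z z' (<n z<K) (<n z'<K))
      (λ z z' z<1 z'<1 _ → trans (n<1⇒n≡0 z<1) (sym (n<1⇒n≡0 z'<1)))
      (λ z _ z<K _ colz≡colk → <⇒≢ (<-≤-trans z<K K≤k) (f-injective z k (<n z<K) k<n colz≡colk))))
    where
    open BijectionOn col-bijection
    <n : ∀ {z} → z < K → z < n
    <n z<K = <-≤-trans z<K (≤-trans K≤k (<⇒≤ k<n))
    col<K : ∀ z → z < K → col z < K
    col<K z z<K = ∀<n (λ z → z < K → col z < K) (λ i i<K → subst (_< K) (sym (col-toℕ i)) (cut i i<K)) z (<n z<K) z<K

  sameSection⊎contented : ∀ i j → toℕ i < toℕ j → SameSection P i j ⊎ Contented P i j
  sameSection⊎contented i j i<j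
    with any? {n = suc n} (λ k → (toℕ i <? toℕ k) ×-dec ((toℕ k ≤? toℕ j) ×-dec cut? (toℕ k)))
  ... | yes (k , i<k , k≤j , cut) =
    inj₂ (<-≤-trans (cut i i<k) (subst (toℕ k ≤_) (col-toℕ j) (cut-closed cut k≤j (toℕ<n j))))
  ... | no noCut = inj₁ λ K cut → (λ K≤i → ≤-trans K≤i (<⇒≤ i<j)) , K≤i-of cut
    where
    K≤i-of : ∀ {K} → Cut P K → K ≤ toℕ j → K ≤ toℕ i
    K≤i-of {K} cut K≤j with K ≤? toℕ i
    ... | yes K≤i = K≤i
    ... | no K≰i = ⊥-elim (noCut (fromℕ< K<n+1 , subst (toℕ i <_) (sym e) (≰⇒> K≰i) ,
                                  subst (_≤ toℕ j) (sym e) K≤j , subst (Cut P) (sym e) cut))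
      where
      K<n+1 : K < suc n
      K<n+1 = s≤s (≤-trans K≤j (<⇒≤ (toℕ<n j)))
      e : toℕ (fromℕ< K<n+1) ≡ K
      e = toℕ-fromℕ< K<n+1

  -- The middle row of a 321 pattern is not neutral; if it is positive it is inverted with the
  -- (positive) first row, if negative with the (negative) last row, and canonicity forbids both.
  strangCanonical⇒avoids321 : TraceZero P → StrangCanonical P → Avoids321 col n
  strangCanonical⇒avoids321 trace0 (upper , lower) p q s p<q q<s s<n cols<colq colq<colp =
    avoidsᶠ (fromℕ< p<n) (fromℕ< q<n) (fromℕ< s<n)
      (subst₂ _<_ (sym (toℕ-fromℕ< p<n)) (sym (toℕ-fromℕ< q<n)) p<q)
      (subst₂ _<_ (sym (toℕ-fromℕ< q<n)) (sym (toℕ-fromℕ< s<n)) q<s)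
      (subst₂ _<_ (col≡c s s<n) (col≡c q q<n) cols<colq)
      (subst₂ _<_ (col≡c q q<n) (col≡c p p<n) colq<colp)
    where
    q<n = <-trans q<s s<n
    p<n = <-trans p<q q<n
    col≡c : ∀ k (k<n : k < n) → col k ≡ c P (fromℕ< k<n)
    col≡c k k<n = trans (cong col (sym (toℕ-fromℕ< k<n))) (col-toℕ (fromℕ< k<n))

    contented : ∀ i j → toℕ i < toℕ j → (SameSection P i j → Contented P i j) → Contented P i j
    contented i j i<j inSection with sameSection⊎contented i j i<j
    ... | inj₁ same = inSection same
    ... | inj₂ ok   = ok

    avoidsᶠ : ∀ a b e → toℕ a < toℕ b → toℕ b < toℕ e → c P e < c P b → c P b < c P a → ⊥
    avoidsᶠ a b e a<b b<e ce<cb cb<ca with <-cmp (c P b) (toℕ b)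
    ... | tri≈ _ cb≡b _ = trace0 b cb≡b
    ... | tri> _ _ b<cb = <-asym cb<ca (contented a b a<b λ same →
                            upper a b same a<b (<-trans a<b (<-trans b<cb cb<ca)) b<cb)
    ... | tri< cb<b _ _ = <-asym ce<cb (contented b e b<e λ same →
                            lower b e same b<e cb<b (<-trans ce<cb (<-trans cb<b b<e)))

sortMatrixInRounds : ∀ {n} (P : PermMatrix n) t → Avoids321 (col P) n →
  (∀ {d i j} → NestedInversions (col P) n d i j → d ≤ t) →
  Σ (List (PermMatrix n)) λ Qs → length Qs ≤ t × All BandwidthAtMost1 Qs × (P ≈ product Qs)
sortMatrixInRounds P t avoids depth≤t
  with sortInRounds t (col P) (row P) (col-bijection P) avoids depth≤t
... | Qs , length≤ , bands , product≡ =
  Qs , length≤ , bands , λ i → toℕ-injective (trans (sym (col-toℕ P i)) (sym (product≡ i)))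

0<bandwidth : ∀ {n} (P : PermMatrix (suc n)) → TraceZero P → 0 < bandwidth P
0<bandwidth P trace0 =
  ≤-trans (n≢0⇒n>0 (trace0 Data.Fin.zero)) (≤-trans (m≤m+n _ _) (dist≤bandwidth P Data.Fin.zero))

theorem2p12 : (n : ℕ) → 1 ≤ n → (P : PermMatrix n) →
    TraceZero P → Settled P → StrangCanonical P →
    Σ (List (PermMatrix n)) (λ Qs →
      (length Qs < 2 * bandwidth P) × All BandwidthAtMost1 Qs × (P ≈ product Qs))
theorem2p12 (suc n) _ P trace0 _ canonical =
  let Qs , length≤ , rest = sortMatrixInRounds P (pred (2 * w)) avoids depth≤
  in  Qs , m≤pred[n]⇒suc[m]≤n {{>-nonZero 0<2w}} length≤ , rest
  where
  w = bandwidth P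
  avoids = strangCanonical⇒avoids321 P trace0 canonical
  open NestBound (col-bijection P) avoids

  depth≤ : ∀ {d i j} → NestedInversions (col P) (suc n) d i j → d ≤ pred (2 * w)
  depth≤ = suc[m]≤n⇒m≤pred[n] ∘ nested-depth<2w w (col-dist≤bandwidth P)

  0<2w : 0 < 2 * w
  0<2w = ≤-trans (0<bandwidth P trace0) (m≤m+n w (w + 0))
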